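{- Let $X$ be a set and let $(\mathcal{A}_i)_{i=0}^{k-1}$ be a sequence of pairwise disjoint saturated antichains in $\mathcal{P}(X)$, each of which has a homogeneous set. Then $(\mathcal{A}_i)_{i=0}^{k-1}$ is layered if and only if $(\mathcal{A}_i^{\mathrm{small}})_{i=0}^{k-1}$ is layered.
   Context: A collection $\mathcal{A}\subseteq\mathcal{P}(X)$ is an antichain if there are no $A,B\in\mathcal{A}$ with $A\subsetneq B$; it is saturated if moreover for every $S\in\mathcal{P}(X)\setminus\mathcal{A}$ there is $A\in\mathcal{A}$ with $A\subsetneq S$ or $S\subsetneq A$. A set $A\subseteq X$ is an atom for $\mathcal{A}$ if it is maximal with respect to the property that $S\cap A\in\{\emptyset,A\}$ for all $S\in\mathcal{A}$; an atom with $|A|\ge2$ is homogeneous for $\mathcal{A}$ (a saturated antichain has at most one homogeneous set). For the homogeneous set $H_i$ of $\mathcal{A}_i$, $\mathcal{A}_i^{\mathrm{small}}$ is the collection of sets $S\in\mathcal{A}_i$ with $S\cap H_i=\emptyset$. A sequence $(\mathcal{D}_i)_{i=0}^{t}$ of subsets of $\mathcal{P}(X)$ is layered if for $1\le i\le t$ every $D\in\mathcal{D}_i$ strictly contains some $D'\in\mathcal{D}_{i-1}$. -}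

module Defs where

open import Data.Nat using (ℕ; suc; _≤_)
open import Data.Fin using (Fin; toℕ)
open import Data.Fin.Subset using (Subset; _⊂_; _⊆_; _∩_; ⊥; ∣_∣)
open import Data.Product using (Σ; ∃; _×_)
open import Data.Sum using (_⊎_)
open import Relation.Nullary using (¬_)
open import Relation.Binary.PropositionalEquality using (_≡_)

-- The ground set X is a finite set, represented as Fin n.
-- A collection 𝒜 ⊆ P(X) is a predicate on subsets of Fin n.
Coll : ℕ → Set₁
Coll n = Subset n → Set

module _ {n : ℕ} where

  IsAntichain : Coll n → Set
  IsAntichain 𝒜 = ∀ A B → 𝒜 A → 𝒜 B → ¬ (A ⊂ B)

  IsSaturated : Coll n → Set
  IsSaturated 𝒜 =
    IsAntichain 𝒜 ×
    (∀ S → ¬ 𝒜 S → Σ (Subset n) λ A → 𝒜 A × (A ⊂ S ⊎ S ⊂ A))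

  Splitless : Coll n → Subset n → Set
  Splitless 𝒜 A = ∀ S → 𝒜 S → (S ∩ A ≡ ⊥) ⊎ (S ∩ A ≡ A)

  IsAtom : Coll n → Subset n → Set
  IsAtom 𝒜 A = Splitless 𝒜 A × (∀ B → Splitless 𝒜 B → A ⊆ B → B ≡ A)

  IsHomogeneous : Coll n → Subset n → Set
  IsHomogeneous 𝒜 H = IsAtom 𝒜 H × (2 ≤ ∣ H ∣)

  Small : Coll n → Subset n → Coll n
  Small 𝒜 H S = 𝒜 S × (S ∩ H ≡ ⊥)

  Layered : {k : ℕ} → (Fin k → Coll n) → Set
  Layered {k} 𝒟 = ∀ (i j : Fin k) → toℕ j ≡ suc (toℕ i) →
    ∀ D → 𝒟 j D → Σ (Subset n) λ D' → 𝒟 i D' × D' ⊂ D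

  PairwiseDisjoint : {k : ℕ} → (Fin k → Coll n) → Set
  PairwiseDisjoint {k} 𝒜 = ∀ (i j : Fin k) → ¬ (i ≡ j) → ∀ S → 𝒜 i S → ¬ 𝒜 j S

{-# OPTIONS --safe #-}
-- A homogeneous set H of a saturated antichain 𝒜 is split by no member. For
-- W ⊇ H and y ∈ H the set W - y does split H, so it is not in 𝒜 and saturation
-- compares it with some R ∈ 𝒜: either R ⊂ W - y, so R misses y and hence all
-- of H, or W - y ⊂ R, so R meets H, contains y and hence all of W. Thus if a
-- member of 𝒜 lies strictly below W, so does a member of 𝒜^small, which is the
-- forward direction. Conversely, D ∈ 𝒜_{i+1} is not in 𝒜_i, so saturation of
-- 𝒜_i puts D strictly above or below some R ∈ 𝒜_i; in the latter case a small
-- member of 𝒜_{i+1}, and then a member of 𝒜_i, would lie strictly below R.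
module Submission where

open import Defs
open import Data.Nat using (ℕ; s≤s; _≤_)
open import Data.Nat.Properties using (1+n≢n)
open import Data.Fin using (Fin; zero; suc; _≟_)
open import Data.Fin.Properties using (suc-injective)
open import Data.Fin.Subset
  using (Subset; Nonempty; _∈_; _∉_; _⊆_; _⊂_; _∩_; _-_; ⁅_⁆; ⊥; ∣_∣; inside; outside)
open import Data.Fin.Subset.Properties
  using (∉⊥; x∈p∩q⁺; x∈p∩q⁻; x∈p∧x≢y⇒x∈p-y; p─q⊆p; ⊆-trans; ⊂-trans; ⊂-⊆-trans)
open import Data.Vec.Base using (_∷_; here; there)
open import Data.Product using (Σ; ∃; ∃₂; _×_; _,_; proj₁; proj₂)
open import Data.Sum using (_⊎_; inj₁; inj₂; [_,_]′)
open import Function using (id)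
open import Relation.Nullary using (¬_; yes; no; contradiction)
open import Relation.Binary.PropositionalEquality using (_≡_; _≢_; refl; subst; sym)

1≤∣p∣⇒Nonempty : ∀ {n} (p : Subset n) → 1 ≤ ∣ p ∣ → Nonempty p
1≤∣p∣⇒Nonempty (inside  ∷ p) _     = zero , here
1≤∣p∣⇒Nonempty (outside ∷ p) 1≤∣p∣ =
  let x , x∈p = 1≤∣p∣⇒Nonempty p 1≤∣p∣ in suc x , there x∈p

2≤∣p∣⇒distinct : ∀ {n} (p : Subset n) → 2 ≤ ∣ p ∣ →
                 ∃₂ λ x y → x ∈ p × y ∈ p × x ≢ y
2≤∣p∣⇒distinct (inside ∷ p) (s≤s 1≤∣p∣) =
  let y , y∈p = 1≤∣p∣⇒Nonempty p 1≤∣p∣ in zero , suc y , here , there y∈p , λ ()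
2≤∣p∣⇒distinct (outside ∷ p) 2≤∣p∣ =
  let x , y , x∈p , y∈p , x≢y = 2≤∣p∣⇒distinct p 2≤∣p∣
  in suc x , suc y , there x∈p , there y∈p , λ sx≡sy → x≢y (suc-injective sx≡sy)

x∉p-x : ∀ {n} (p : Subset n) (x : Fin n) → x ∉ p - x
x∉p-x (_ ∷ p) zero    ()
x∉p-x (_ ∷ p) (suc x) (there x∈p-x) = x∉p-x p x x∈p-x

module _ {n : ℕ} {p q : Subset n} where

  p-x⊆q∧x∈q⇒p⊆q : ∀ {x} → p - x ⊆ q → x ∈ q → p ⊆ q
  p-x⊆q∧x∈q⇒p⊆q {x} p-x⊆q x∈q {y} y∈p with y ≟ x
  ... | yes refl = x∈q
  ... | no  y≢x  = p-x⊆q (x∈p∧x≢y⇒x∈p-y y∈p y≢x)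

  p∩q≡⊥∧x∈q⇒x∉p : ∀ {x} → p ∩ q ≡ ⊥ → x ∈ q → x ∉ p
  p∩q≡⊥∧x∈q⇒x∉p p∩q≡⊥ x∈q x∈p = ∉⊥ (subst (_ ∈_) p∩q≡⊥ (x∈p∩q⁺ (x∈p , x∈q)))

  p∩q≡q⇒q⊆p : p ∩ q ≡ q → q ⊆ p
  p∩q≡q⇒q⊆p p∩q≡q x∈q = proj₁ (x∈p∩q⁻ p q (subst (_ ∈_) (sym p∩q≡q) x∈q))

module _ {n : ℕ} {𝒜 : Coll n} {H : Subset n} (H-splitless : Splitless 𝒜 H) where

  meets⇒⊇ : ∀ {S x} → 𝒜 S → x ∈ H → x ∈ S → H ⊆ S
  meets⇒⊇ {S} aS x∈H x∈S with H-splitless S aS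
  ... | inj₁ S∩H≡⊥ = contradiction x∈S (p∩q≡⊥∧x∈q⇒x∉p S∩H≡⊥ x∈H)
  ... | inj₂ S∩H≡H = p∩q≡q⇒q⊆p S∩H≡H

  misses⇒small : ∀ {S y} → 𝒜 S → y ∈ H → y ∉ S → Small 𝒜 H S
  misses⇒small {S} aS y∈H y∉S with H-splitless S aS
  ... | inj₁ S∩H≡⊥ = aS , S∩H≡⊥
  ... | inj₂ S∩H≡H = contradiction (p∩q≡q⇒q⊆p S∩H≡H y∈H) y∉S

  splits⇒∉ : ∀ {S x y} → x ∈ H → x ∈ S → y ∈ H → y ∉ S → ¬ 𝒜 S
  splits⇒∉ x∈H x∈S y∈H y∉S aS = y∉S (meets⇒⊇ aS x∈H x∈S y∈H)

StrictlyBelow : ∀ {n} → Coll n → Coll n → Set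
StrictlyBelow {n} 𝒜 ℬ = ∀ D → ℬ D → Σ (Subset n) λ D' → 𝒜 D' × D' ⊂ D

StrictlyBelow-mono : ∀ {n} {𝒜 ℬ 𝒜′ ℬ′ : Coll n} →
                     (∀ {S} → 𝒜 S → 𝒜′ S) → (∀ {S} → ℬ′ S → ℬ S) →
                     StrictlyBelow 𝒜 ℬ → StrictlyBelow 𝒜′ ℬ′
StrictlyBelow-mono 𝒜⊆𝒜′ ℬ′⊆ℬ below D bD =
  let D' , aD' , D'⊂D = below D (ℬ′⊆ℬ bD) in D' , 𝒜⊆𝒜′ aD' , D'⊂D

module _ {n : ℕ} {𝒜 : Coll n} {H : Subset n}
         (sat : IsSaturated 𝒜) (H-splitless : Splitless 𝒜 H) (2≤∣H∣ : 2 ≤ ∣ H ∣) where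

  module _ {W : Subset n} (H⊆W : H ⊆ W) {x y : Fin n}
           (x∈H : x ∈ H) (y∈H : y ∈ H) (x≢y : x ≢ y) where

    private
      x∈W-y : x ∈ W - y
      x∈W-y = x∈p∧x≢y⇒x∈p-y (H⊆W x∈H) x≢y

      W-y∉𝒜 : ¬ 𝒜 (W - y)
      W-y∉𝒜 = splits⇒∉ H-splitless x∈H x∈W-y y∈H (x∉p-x W y)

    small-below⊎above : (∃ λ R → Small 𝒜 H R × R ⊂ W) ⊎ (∃ λ R → 𝒜 R × W ⊆ R)
    small-below⊎above with proj₂ sat (W - y) W-y∉𝒜
    ... | R , aR , inj₁ R⊂W-y = inj₁ (R , R-small , ⊂-⊆-trans R⊂W-y (p─q⊆p W ⁅ y ⁆))
      where
      R-small : Small 𝒜 H R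
      R-small = misses⇒small H-splitless aR y∈H (λ y∈R → x∉p-x W y (proj₁ R⊂W-y y∈R))
    ... | R , aR , inj₂ W-y⊂R = inj₂ (R , aR , p-x⊆q∧x∈q⇒p⊆q (proj₁ W-y⊂R) y∈R)
      where
      y∈R : y ∈ R
      y∈R = meets⇒⊇ H-splitless aR x∈H (proj₁ W-y⊂R x∈W-y) y∈H

  small-below : ∀ {A W} → 𝒜 A → A ⊂ W → ∃ λ R → Small 𝒜 H R × R ⊂ W
  small-below {A} {W} aA A⊂W with H-splitless A aA
  ... | inj₁ A∩H≡⊥ = A , (aA , A∩H≡⊥) , A⊂W
  ... | inj₂ A∩H≡H =
    let x , y , x∈H , y∈H , x≢y = 2≤∣p∣⇒distinct H 2≤∣H∣
    in [ id , above-impossible ]′ (small-below⊎above H⊆W x∈H y∈H x≢y)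
    where
    H⊆W : H ⊆ W
    H⊆W = ⊆-trans (p∩q≡q⇒q⊆p A∩H≡H) (proj₁ A⊂W)

    above-impossible : (∃ λ R → 𝒜 R × W ⊆ R) → ∃ λ R → Small 𝒜 H R × R ⊂ W
    above-impossible (R , aR , W⊆R) = contradiction (⊂-⊆-trans A⊂W W⊆R) (proj₁ sat A R aA aR)

  below⇒small-below : ∀ {ℬ} → StrictlyBelow 𝒜 ℬ → StrictlyBelow (Small 𝒜 H) ℬ
  below⇒small-below below D bD = let A , aA , A⊂D = below D bD in small-below aA A⊂D

module _ {n : ℕ} {𝒜 ℬ : Coll n} {H : Subset n}
         (𝒜-sat : IsSaturated 𝒜) (ℬ-sat : IsSaturated ℬ) (H-splitless : Splitless ℬ H)
         (2≤∣H∣ : 2 ≤ ∣ H ∣) (disjoint : ∀ {S} → 𝒜 S → ¬ ℬ S) where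

  below-small⇒below : StrictlyBelow 𝒜 (Small ℬ H) → StrictlyBelow 𝒜 ℬ
  below-small⇒below below D bD with proj₂ 𝒜-sat D (λ aD → disjoint aD bD)
  ... | R , aR , inj₁ R⊂D = R , aR , R⊂D
  ... | R , aR , inj₂ D⊂R =
    let R' , R'-small , R'⊂R = small-below ℬ-sat H-splitless 2≤∣H∣ bD D⊂R
        P , aP , P⊂R' = below R' R'-small
    in contradiction (⊂-trans P⊂R' R'⊂R) (proj₁ 𝒜-sat P R aP aR)

lemma2p9 : (n k : ℕ) (𝒜 : Fin k → Coll n) (H : Fin k → Subset n) →
    (∀ i → IsSaturated (𝒜 i)) → PairwiseDisjoint 𝒜 →
    (∀ i → IsHomogeneous (𝒜 i) (H i)) →
    (Layered 𝒜 → Layered (λ i → Small (𝒜 i) (H i))) ×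
    (Layered (λ i → Small (𝒜 i) (H i)) → Layered 𝒜)
lemma2p9 n k 𝒜 H sat disjoint hom = layered⇒small-layered , small-layered⇒layered
  where
  splitless : ∀ i → Splitless (𝒜 i) (H i)
  splitless i = proj₁ (proj₁ (hom i))

  2≤∣H∣ : ∀ i → 2 ≤ ∣ H i ∣
  2≤∣H∣ i = proj₂ (hom i)

  layered⇒small-layered : Layered 𝒜 → Layered (λ i → Small (𝒜 i) (H i))
  layered⇒small-layered layered i j j≡1+i =
    StrictlyBelow-mono id proj₁
      (below⇒small-below (sat i) (splitless i) (2≤∣H∣ i) (layered i j j≡1+i))

  small-layered⇒layered : Layered (λ i → Small (𝒜 i) (H i)) → Layered 𝒜
  small-layered⇒layered small-layered i j j≡1+i =
    below-small⇒below (sat i) (sat j) (splitless j) (2≤∣H∣ j) (disjoint i j i≢j _)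
      (StrictlyBelow-mono proj₁ id (small-layered i j j≡1+i))
    where
    i≢j : i ≢ j
    i≢j refl = 1+n≢n (sym j≡1+i)
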